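{- Let $\rho$ be a positive integer and let $\bar T = (T_0, \ldots, T_\ell)$ be a $\rho$-minimal triangle sequence (with associated vertices $v_i$ and edges $e_i$, $i \in [\ell]$). Then: (a) $r(\bar T) = \rho$; (b) there are at most $\rho$ irregular steps; (c) for all but at most $\rho(\rho+2)$ regular steps $i$, there is an edge $f_i$ of $T_\ell$ joining $v_i$ to an endpoint of $e_i$ such that $f_i$ forms a triangle in $T_\ell$ together with $v_j$ for some $j > i$.
   Context: A triangle sequence is a sequence of graphs $T_0, \ldots, T_\ell = T$ together with vertices $v_i$ and edges $e_i$ ($i\in[\ell]$) such that $T_0$ is a triangle and, for each $i \in [\ell]$, $v_i \in V(T)\setminus V(T_{i-1})$, $e_i \in E(T_{i-1})$, $v_i$ together with $e_i$ forms a triangle in $T$, $V(T_i) = V(T_{i-1}) \cup \{v_i\}$, and $E(T_i)$ is $E(T_{i-1})$ together with all edges of $T$ between $v_i$ and $V(T_{i-1})$. Step $i \in [\ell]$ is regular if $\deg(v_i, T_{i-1}) = 2$ (the number of neighbours of $v_i$ in $V(T_{i-1})$) and irregular otherwise. Define $r(\bar T) = \sum_{i\in[\ell]} (\deg(v_i, T_{i-1}) - 2)$. For a positive integer $\rho$, a triangle sequence $\bar T = (T_0,\ldots,T_\ell)$ is $\rho$-minimal if $r(\bar T) \ge \rho$ and there is no triangle sequence $\bar T' = (T'_0, \ldots, T'_{\ell'})$ with $r(\bar T') \ge \rho$ and $T'_{\ell'}$ a proper subgraph of $T_\ell$. -}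

module Defs where

open import Data.Nat using (ℕ; _+_; _*_; _∸_; _≤_; _≥_; _≡ᵇ_)
open import Data.Nat.ListAction using (sum)
open import Data.Bool using (Bool; true; false; not)
open import Data.Fin using (Fin; _<_; _<?_)
open import Data.List using (List; _∷_; []; map; filter; length; allFin; filterᵇ)
open import Data.List.Membership.Propositional using (_∈_; _∉_)
open import Data.List.Relation.Unary.Unique.Propositional using (Unique)
open import Data.Product using (_×_; _,_; Σ; ∃; proj₁; proj₂)
open import Data.Sum using (_⊎_)
open import Relation.Binary.PropositionalEquality using (_≡_; _≢_)
open import Relation.Nullary using (¬_)
open import Function.Bundles using (_⇔_)

record Graph : Set where
  field
    V      : ℕ → Bool
    E      : ℕ → ℕ → Bool
    E-sym  : ∀ x y → E x y ≡ E y x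
    E-irr  : ∀ x → E x x ≡ false
    E-V    : ∀ x y → E x y ≡ true → V x ≡ true
open Graph public

Adj : Graph → ℕ → ℕ → Set
Adj G x y = E G x y ≡ true

_⊆G_ : Graph → Graph → Set
G' ⊆G G = (∀ x → V G' x ≡ true → V G x ≡ true) × (∀ x y → E G' x y ≡ true → E G x y ≡ true)

_⊂G_ : Graph → Graph → Set
G' ⊂G G = (G' ⊆G G) × ¬ (G ⊆G G')

-- T₀ is the triangle on x₀ x₁ x₂; step i (i : Fin ℓ, 0-based; step i+1 in the paper)
-- adds vertex v i and uses the edge e i = (a , b) of the previous graph.
-- Since T_i is determined (vertices added so far, with all edges of T among
-- them), it suffices to record the vertex order and the edges e_i.
record TriSeq (T : Graph) : Set where
  field
    ℓ  : ℕ
    x₀ x₁ x₂ : ℕ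
    v  : Fin ℓ → ℕ
    e  : Fin ℓ → ℕ × ℕ

  pre : Fin ℓ → List ℕ
  pre i = x₀ ∷ x₁ ∷ x₂ ∷ map v (filter (λ j → j <? i) (allFin ℓ))

  allV : List ℕ
  allV = x₀ ∷ x₁ ∷ x₂ ∷ map v (allFin ℓ)

  field
    distinct  : Unique allV
    covers    : ∀ x → (V T x ≡ true) ⇔ (x ∈ allV)
    tri       : Adj T x₀ x₁ × Adj T x₁ x₂ × Adj T x₀ x₂
    e-pre     : ∀ i → (proj₁ (e i) ∈ pre i) × (proj₂ (e i) ∈ pre i)
    e-edge    : ∀ i → Adj T (proj₁ (e i)) (proj₂ (e i))
    v-tri     : ∀ i → Adj T (v i) (proj₁ (e i)) × Adj T (v i) (proj₂ (e i))

  deg : Fin ℓ → ℕ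
  deg i = length (filterᵇ (E T (v i)) (pre i))

  regular : Fin ℓ → Set
  regular i = deg i ≡ 2

  -- r(T̄) = Σ_i (deg(v_i,T_{i-1}) - 2)   (each deg ≥ 2, so ∸ is exact)
  r : ℕ
  r = sum (map (λ i → deg i ∸ 2) (allFin ℓ))

  irregularCount : ℕ
  irregularCount = length (filterᵇ (λ i → not (deg i ≡ᵇ 2)) (allFin ℓ))

open TriSeq public

Minimal : ℕ → {T : Graph} → TriSeq T → Set
Minimal ρ {T} S = (r S ≥ ρ) ×
  (∀ (T' : Graph) (S' : TriSeq T') → r S' ≥ ρ → ¬ (T' ⊂G T))

GoodStep : {T : Graph} (S : TriSeq T) → Fin (ℓ S) → Set
GoodStep {T} S i =
  Σ ℕ λ w → ((w ≡ proj₁ (e S i)) ⊎ (w ≡ proj₂ (e S i))) ×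
    Adj T (v S i) w ×
    Σ (Fin (ℓ S)) λ j → (i < j) × Adj T (v S j) (v S i) × Adj T (v S j) w

{-# OPTIONS --safe #-}
module Submission where

-- If r exceeded ρ, the last vertex v_k would have no later neighbour, and deleting v_k (when step k
-- is regular) or an edge from v_k to an earlier neighbour outside e_k (when it is not) would give a
-- triangle sequence of a proper subgraph with r still ≥ ρ.  So r = ρ, which bounds the number of
-- irregular steps by ρ and every degree by ρ + 2.  The exceptional steps are the earlier neighbours
-- of irregular steps, at most ρ (ρ + 2) of them.  A regular step i that is not exceptional has a
-- later neighbour v_k, since otherwise deleting v_i would keep r.  Step k is then regular, so v_i is
-- an endpoint of e_k, and the other endpoint c is adjacent to both v_i and v_k.  Either c precedes
-- v_i, so that it is an endpoint of e_i and v_k closes the required triangle, or c = v_m with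
-- i < m < k is a nearer later neighbour of v_i, and we descend.

open import Defs
open import Data.Nat using (ℕ; zero; suc; pred; _+_; _*_; _∸_; _≤_; _<_; _≥_; _≡ᵇ_; z≤n; s≤s; s≤s⁻¹)
open import Data.Nat.Properties hiding (_<?_)
open import Algebra.Properties.CommutativeMonoid.Sum +-0-commutativeMonoid
  using (sum-remove; sum-cong-≗) renaming (sum to ∑)
open import Data.Nat.ListAction using (sum)
open import Data.Bool using (Bool; true; false; not; T; _∧_; _∨_)
open import Data.Bool.Properties as Bool using (T-∧; T-∨; ∧-comm; ∨-comm)
open import Data.Empty using (⊥-elim)
open import Data.Fin as Fin using (Fin; zero; suc; punchIn; punchOut; fromℕ; _<?_)
import Data.Fin.Properties as Fin
open import Data.Fin.Induction using (<-wellFounded)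
open import Induction.WellFounded using (Acc; acc)
open import Data.List using (List; []; _∷_; _++_; map; filter; filterᵇ; length; allFin; concatMap; tabulate)
open import Data.List.Properties using (map-tabulate; length-map; length-removeAt′; length-++)
open import Data.List.Relation.Unary.Any using (here; there; _─_; any?)
open import Data.List.Relation.Unary.All as All using ([]; _∷_)
open import Data.List.Relation.Unary.All.Properties using (¬All⇒Any¬)
import Data.List.Relation.Unary.AllPairs.Properties as AllPairs
open import Data.List.Relation.Unary.AllPairs using ([]; _∷_)
open import Data.List.Relation.Unary.Unique.Propositional using (Unique)
import Data.List.Relation.Unary.Unique.Propositional.Properties as Unique
open import Data.List.Relation.Binary.Subset.Propositional using (_⊆_)
open import Data.List.Membership.Propositional using (_∈_; _∉_; find; lose)
open import Data.List.Membership.Propositional.Properties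
  using (∈-++⁺ˡ; ∈-++⁺ʳ; ∈-++⁻; ∈-map⁺; ∈-map⁻; ∈-filter⁺; ∈-filter⁻; ∈-allFin; ∈-AllPairs₂; ∈-concat⁺′)
open import Data.Product using (_×_; _,_; Σ; ∃-syntax; proj₁; proj₂)
open import Data.Sum using (_⊎_; inj₁; inj₂; [_,_])
open import Function using (_∘_; _⇔_; Equivalence; mk⇔)
open import Relation.Binary.Definitions using (DecidableEquality; tri<; tri≈; tri>)
open import Relation.Binary.PropositionalEquality using (_≡_; _≢_; refl; sym; trans; cong; cong₂; subst; module ≡-Reasoning)
open import Relation.Nullary using (¬_; Dec; yes; no)
open import Relation.Nullary.Decidable using (_×-dec_)

∧-≡true⁺ : ∀ {a b} → a ≡ true → b ≡ true → a ∧ b ≡ true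
∧-≡true⁺ refl refl = refl

∧-≡true⁻ : ∀ {a b} → a ∧ b ≡ true → a ≡ true × b ≡ true
∧-≡true⁻ {true} {true} _ = refl , refl

not-≡true⁺ : ∀ {b} → ¬ T b → not b ≡ true
not-≡true⁺ {false} _  = refl
not-≡true⁺ {true}  ¬b = ⊥-elim (¬b _)

not-≡true⁻ : ∀ {b} → not b ≡ true → ¬ T b
not-≡true⁻ {false} _ ()

≢⇒not≡ᵇ : ∀ {x y} → x ≢ y → not (x ≡ᵇ y) ≡ true
≢⇒not≡ᵇ {x} {y} x≢y = not-≡true⁺ (x≢y ∘ ≡ᵇ⇒≡ x y)

not≡ᵇ⇒≢ : ∀ {x y} → not (x ≡ᵇ y) ≡ true → x ≢ y
not≡ᵇ⇒≢ {x} {y} h = not-≡true⁻ h ∘ ≡⇒≡ᵇ x y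

module _ {A : Set} where

  ∈-─ : ∀ {x y : A} {ys} (x∈ys : x ∈ ys) → y ∈ ys → y ≢ x → y ∈ (ys ─ x∈ys)
  ∈-─ (here refl) (here refl) y≢x = ⊥-elim (y≢x refl)
  ∈-─ (here _)    (there y∈)  _   = y∈
  ∈-─ (there _)   (here refl) _   = here refl
  ∈-─ (there x∈)  (there y∈)  y≢x = there (∈-─ x∈ y∈ y≢x)

  Unique-⊆⇒length≤ : ∀ {xs ys : List A} → Unique xs → xs ⊆ ys → length xs ≤ length ys
  Unique-⊆⇒length≤ {[]}     _               _      = z≤n
  Unique-⊆⇒length≤ {x ∷ xs} {ys} (x∉xs ∷ xs!) xs⊆ys = begin
    suc (length xs)          ≤⟨ s≤s (Unique-⊆⇒length≤ xs! xs⊆ys─x) ⟩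
    suc (length (ys ─ x∈ys)) ≡⟨ length-removeAt′ ys _ ⟨
    length ys                ∎
    where
    open ≤-Reasoning
    x∈ys : x ∈ ys
    x∈ys = xs⊆ys (here refl)
    xs⊆ys─x : xs ⊆ (ys ─ x∈ys)
    xs⊆ys─x y∈xs = ∈-─ x∈ys (xs⊆ys (there y∈xs)) (λ y≡x → All.lookup x∉xs y∈xs (sym y≡x))

  module _ (_≟_ : DecidableEquality A) where
    open import Data.List.Membership.DecPropositional _≟_ using (_∈?_)

    Unique-length>⇒∃∉ : ∀ {xs ys : List A} → Unique xs → length ys < length xs → ∃[ x ] x ∈ xs × x ∉ ys
    Unique-length>⇒∃∉ {xs} {ys} xs! ys<xs with All.all? (_∈? ys) xs
    ... | yes xs⊆ys = ⊥-elim (<⇒≱ ys<xs (Unique-⊆⇒length≤ xs! (All.lookup xs⊆ys)))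
    ... | no  xs⊈ys = find (¬All⇒Any¬ (_∈? ys) xs xs⊈ys)

  length≡2⇒≡⊎≡ : ∀ {xs : List A} {a b c} → length xs ≡ 2 →
                 a ∈ xs → b ∈ xs → a ≢ b → c ∈ xs → c ≡ a ⊎ c ≡ b
  length≡2⇒≡⊎≡ {_ ∷ _ ∷ []} _ (here refl)         (here refl)         a≢b _ = ⊥-elim (a≢b refl)
  length≡2⇒≡⊎≡ {_ ∷ _ ∷ []} _ (there (here refl)) (there (here refl)) a≢b _ = ⊥-elim (a≢b refl)
  length≡2⇒≡⊎≡ {_ ∷ _ ∷ []} _ (here refl)         (there (here refl)) _ (here refl)         = inj₁ refl
  length≡2⇒≡⊎≡ {_ ∷ _ ∷ []} _ (here refl)         (there (here refl)) _ (there (here refl)) = inj₂ refl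
  length≡2⇒≡⊎≡ {_ ∷ _ ∷ []} _ (there (here refl)) (here refl)         _ (here refl)         = inj₂ refl
  length≡2⇒≡⊎≡ {_ ∷ _ ∷ []} _ (there (here refl)) (here refl)         _ (there (here refl)) = inj₁ refl

  Unique-map⇒injective : ∀ {B : Set} {f : A → B} {xs x y} →
                         Unique (map f xs) → x ∈ xs → y ∈ xs → f x ≡ f y → x ≡ y
  Unique-map⇒injective fxs! x∈ y∈ fx≡fy with ∈-AllPairs₂ (AllPairs.map⁻ fxs!) x∈ y∈
  ... | inj₁ x≡y         = x≡y
  ... | inj₂ (inj₁ fx≢fy) = ⊥-elim (fx≢fy fx≡fy)
  ... | inj₂ (inj₂ fy≢fx) = ⊥-elim (fy≢fx (sym fx≡fy))

  Unique-++⇒∉ : ∀ xs {ys : List A} {x} → Unique (xs ++ ys) → x ∈ xs → x ∉ ys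
  Unique-++⇒∉ (_ ∷ xs) (x∉ ∷ _)   (here refl) x∈ys = All.lookup x∉ (∈-++⁺ʳ xs x∈ys) refl
  Unique-++⇒∉ (_ ∷ xs) (_ ∷ xys!) (there x∈)  x∈ys = Unique-++⇒∉ xs xys! x∈ x∈ys

  ∈-filterᵇ⁺ : ∀ {p : A → Bool} {x xs} → x ∈ xs → p x ≡ true → x ∈ filterᵇ p xs
  ∈-filterᵇ⁺ {p} x∈ px = ∈-filter⁺ (Bool.T? ∘ p) x∈ (Equivalence.from Bool.T-≡ px)

  ∈-filterᵇ⁻ : ∀ {p : A → Bool} {x} xs → x ∈ filterᵇ p xs → x ∈ xs × p x ≡ true
  ∈-filterᵇ⁻ {p} xs x∈ with ∈-filter⁻ (Bool.T? ∘ p) {xs = xs} x∈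
  ... | x∈xs , px = x∈xs , Equivalence.to Bool.T-≡ px

  Unique-filterᵇ : ∀ (p : A → Bool) {xs} → Unique xs → Unique (filterᵇ p xs)
  Unique-filterᵇ p = Unique.filter⁺ (Bool.T? ∘ p)

  length-concatMap≤ : ∀ {B : Set} (f : A → List B) {c} → (∀ x → length (f x) ≤ c) →
                      ∀ xs → length (concatMap f xs) ≤ length xs * c
  length-concatMap≤ f fx≤c []       = z≤n
  length-concatMap≤ f fx≤c (x ∷ xs) = begin
    length (f x ++ concatMap f xs)          ≡⟨ length-++ (f x) ⟩
    length (f x) + length (concatMap f xs)  ≤⟨ +-mono-≤ (fx≤c x) (length-concatMap≤ f fx≤c xs) ⟩
    _ + length xs * _                       ∎
    where open ≤-Reasoning

  length-filter≢2≤sum∸2 : (f : A → ℕ) → (∀ x → 2 ≤ f x) →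
                          ∀ xs → length (filterᵇ (λ x → not (f x ≡ᵇ 2)) xs) ≤ sum (map (λ x → f x ∸ 2) xs)
  length-filter≢2≤sum∸2 f 2≤f []       = z≤n
  length-filter≢2≤sum∸2 f 2≤f (x ∷ xs) with f x ≡ᵇ 2 in fx≡ᵇ2
  ... | true  = ≤-trans (length-filter≢2≤sum∸2 f 2≤f xs) (m≤n+m _ _)
  ... | false = +-mono-≤ (m<n⇒0<n∸m 2<fx) (length-filter≢2≤sum∸2 f 2≤f xs)
    where
    2<fx : 2 < f x
    2<fx = ≤∧≢⇒< (2≤f x) (λ 2≡fx → subst T fx≡ᵇ2 (≡⇒≡ᵇ (f x) 2 (sym 2≡fx)))

-- ℓ S need not be syntactically a successor, so the steps left after deleting one are indexed by
-- Fin (pred (ℓ S)).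
punchIn′ : ∀ {m} → Fin m → Fin (pred m) → Fin m
punchIn′ {suc _} = punchIn

punchIn′-injective : ∀ {m} (i : Fin m) {j k} → punchIn′ i j ≡ punchIn′ i k → j ≡ k
punchIn′-injective {suc _} i = Fin.punchIn-injective i _ _

punchIn′ᵢ≢i : ∀ {m} (i : Fin m) j → punchIn′ i j ≢ i
punchIn′ᵢ≢i {suc _} = Fin.punchInᵢ≢i

punchIn′-surjective : ∀ {m} (i : Fin m) {k} → k ≢ i → ∃[ j ] punchIn′ i j ≡ k
punchIn′-surjective {suc _} i k≢i = punchOut (k≢i ∘ sym) , Fin.punchIn-punchOut (k≢i ∘ sym)

punchIn′-mono-< : ∀ {m} (i : Fin m) {j k} → j Fin.< k → punchIn′ i j Fin.< punchIn′ i k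
punchIn′-mono-< {suc _} i {j} {k} j<k =
  Fin.≤∧≢⇒< (Fin.punchIn-mono-≤ i j k (<⇒≤ j<k)) (Fin.<⇒≢ j<k ∘ Fin.punchIn-injective i j k)

punchIn′-cancel-< : ∀ {m} (i : Fin m) {j k} → punchIn′ i j Fin.< punchIn′ i k → j Fin.< k
punchIn′-cancel-< {suc _} i {j} {k} pj<pk =
  Fin.≤∧≢⇒< (Fin.punchIn-cancel-≤ i j k (<⇒≤ pj<pk)) (Fin.<⇒≢ pj<pk ∘ cong (punchIn i))

lastIndex : ∀ {m} → Fin m → Σ (Fin m) λ k → ∀ (j : Fin m) → ¬ k Fin.< j
lastIndex {suc n} _ = fromℕ n , λ j k<j → <⇒≱ k<j (Fin.≤fromℕ j)

sum-map-allFin : ∀ {n} (f : Fin n → ℕ) → sum (map f (allFin n)) ≡ ∑ f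
sum-map-allFin {zero}  f = refl
sum-map-allFin {suc n} f = cong (f zero +_) (begin
  sum (map f (tabulate suc))      ≡⟨ cong sum (map-tabulate suc f) ⟩
  sum (tabulate (f ∘ suc))        ≡⟨ cong sum (map-tabulate (λ j → j) (f ∘ suc)) ⟨
  sum (map (f ∘ suc) (allFin n))  ≡⟨ sum-map-allFin (f ∘ suc) ⟩
  ∑ (f ∘ suc)                     ∎)
  where open ≡-Reasoning

∑-punchIn′ : ∀ {m} (f : Fin m → ℕ) i → ∑ f ≡ f i + ∑ (f ∘ punchIn′ i)
∑-punchIn′ {suc _} f i = sum-remove {i = i} f

∑-mono-≤ : ∀ {n} {f g : Fin n → ℕ} → (∀ i → f i ≤ g i) → ∑ f ≤ ∑ g
∑-mono-≤ {zero}  _   = z≤n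
∑-mono-≤ {suc n} f≤g = +-mono-≤ (f≤g zero) (∑-mono-≤ (f≤g ∘ suc))

≤∑ : ∀ {n} (f : Fin n → ℕ) i → f i ≤ ∑ f
≤∑ f i = subst (f i ≤_) (sym (∑-punchIn′ f i)) (m≤m+n (f i) _)

suc[m]∸n≤suc[m∸n] : ∀ m n → suc m ∸ n ≤ suc (m ∸ n)
suc[m]∸n≤suc[m∸n] m n =
  m≤n+o⇒m∸n≤o (suc m) n (≤-trans (s≤s (m≤n+m∸n m n)) (≤-reflexive (sym (+-suc n (m ∸ n)))))

0<∑⇒Fin : ∀ {n} (f : Fin n → ℕ) → 0 < ∑ f → Fin n
0<∑⇒Fin {suc _} _ _ = zero

Adj-sym : ∀ {G x y} → Adj G x y → Adj G y x
Adj-sym {G} {x} {y} x~y = trans (E-sym G y x) x~y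

Adj⇒≢ : ∀ {G x y} → Adj G x y → x ≢ y
Adj⇒≢ {G} {x} x~x refl with trans (sym (E-irr G x)) x~x
... | ()

deleteVertex : Graph → ℕ → Graph
deleteVertex G x = record
  { V     = λ y → V G y ∧ not (y ≡ᵇ x)
  ; E     = λ y z → E G y z ∧ (not (y ≡ᵇ x) ∧ not (z ≡ᵇ x))
  ; E-sym = λ y z → cong₂ _∧_ (E-sym G y z) (∧-comm (not (y ≡ᵇ x)) _)
  ; E-irr = λ y → cong (_∧ _) (E-irr G y)
  ; E-V   = λ y z y~z → ∧-≡true⁺ (E-V G y z (proj₁ (∧-≡true⁻ y~z)))
                                 (proj₁ (∧-≡true⁻ (proj₂ (∧-≡true⁻ {E G y z} y~z))))
  }

module _ {G : Graph} {x : ℕ} where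

  deleteVertex-Adj⁺ : ∀ {y z} → Adj G y z → y ≢ x → z ≢ x → Adj (deleteVertex G x) y z
  deleteVertex-Adj⁺ y~z y≢x z≢x = ∧-≡true⁺ y~z (∧-≡true⁺ (≢⇒not≡ᵇ y≢x) (≢⇒not≡ᵇ z≢x))

  deleteVertex-Adj⁻ : ∀ {y z} → Adj (deleteVertex G x) y z → Adj G y z
  deleteVertex-Adj⁻ {y} {z} = proj₁ ∘ ∧-≡true⁻ {E G y z}

  deleteVertex-V⁺ : ∀ {y} → V G y ≡ true → y ≢ x → V (deleteVertex G x) y ≡ true
  deleteVertex-V⁺ Vy y≢x = ∧-≡true⁺ Vy (≢⇒not≡ᵇ y≢x)

  deleteVertex-V⁻ : ∀ {y} → V (deleteVertex G x) y ≡ true → V G y ≡ true × y ≢ x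
  deleteVertex-V⁻ {y} V′y with ∧-≡true⁻ {V G y} V′y
  ... | Vy , y≢ᵇx = Vy , not≡ᵇ⇒≢ y≢ᵇx

  deleteVertex-⊂ : V G x ≡ true → deleteVertex G x ⊂G G
  deleteVertex-⊂ Vx = ((λ _ → proj₁ ∘ deleteVertex-V⁻) , λ _ _ → deleteVertex-Adj⁻)
                    , λ G⊆G′ → proj₂ (deleteVertex-V⁻ (proj₁ G⊆G′ x Vx)) refl

deleteEdge : Graph → ℕ → ℕ → Graph
deleteEdge G a b = record
  { V     = V G
  ; E     = λ y z → E G y z ∧ not (((y ≡ᵇ a) ∧ (z ≡ᵇ b)) ∨ ((y ≡ᵇ b) ∧ (z ≡ᵇ a)))
  ; E-sym = λ y z → cong₂ _∧_ (E-sym G y z)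
                      (cong not (trans (∨-comm ((y ≡ᵇ a) ∧ (z ≡ᵇ b)) _) (cong₂ _∨_ (∧-comm (y ≡ᵇ b) _) (∧-comm (y ≡ᵇ a) _))))
  ; E-irr = λ y → cong (_∧ _) (E-irr G y)
  ; E-V   = λ y z → E-V G y z ∘ proj₁ ∘ ∧-≡true⁻ {E G y z}
  }

module _ {G : Graph} {a b : ℕ} where

  deleteEdge-Adj⁺ : ∀ {y z} → Adj G y z → (y ≡ a → z ≢ b) → (y ≡ b → z ≢ a) → Adj (deleteEdge G a b) y z
  deleteEdge-Adj⁺ {y} {z} y~z ab-avoided ba-avoided =
    ∧-≡true⁺ y~z (not-≡true⁺ ([ avoided ab-avoided , avoided ba-avoided ] ∘ Equivalence.to T-∨))
    where
    avoided : ∀ {c d} → (y ≡ c → z ≢ d) → ¬ T ((y ≡ᵇ c) ∧ (z ≡ᵇ d))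
    avoided {c} {d} h t with Equivalence.to T-∧ t
    ... | y≡ᵇc , z≡ᵇd = h (≡ᵇ⇒≡ y c y≡ᵇc) (≡ᵇ⇒≡ z d z≡ᵇd)

  deleteEdge-Adj⁻ : ∀ {y z} → Adj (deleteEdge G a b) y z → Adj G y z
  deleteEdge-Adj⁻ {y} {z} = proj₁ ∘ ∧-≡true⁻ {E G y z}

  deleteEdge-⊂ : Adj G a b → deleteEdge G a b ⊂G G
  deleteEdge-⊂ a~b = ((λ _ Vy → Vy) , λ _ _ → deleteEdge-Adj⁻)
                   , λ G⊆G′ → not-≡true⁻ (proj₂ (∧-≡true⁻ {E G a b} (proj₂ G⊆G′ a b a~b))) ab≡ab
    where
    ab≡ab : T (((a ≡ᵇ a) ∧ (b ≡ᵇ b)) ∨ ((a ≡ᵇ b) ∧ (b ≡ᵇ a)))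
    ab≡ab = Equivalence.from T-∨ (inj₁ (Equivalence.from T-∧ (≡⇒≡ᵇ a a refl , ≡⇒≡ᵇ b b refl)))

-- pre S k and allV S have these shapes with xs = [x₀, x₁, x₂] and w = v S.  Stating the lemmas for
-- arbitrary w lets VertexDeletion apply them to the relabelled sequence before it is a TriSeq.
module _ (xs : List ℕ) {n} (w : Fin n → ℕ) where

  ∈-++-map⁻ : ∀ {y} → y ∈ xs ++ map w (allFin n) → y ∈ xs ⊎ ∃[ m ] y ≡ w m
  ∈-++-map⁻ y∈ with ∈-++⁻ xs y∈
  ... | inj₁ y∈xs = inj₁ y∈xs
  ... | inj₂ y∈ws with ∈-map⁻ w y∈ws
  ... | m , _ , y≡wm = inj₂ (m , y≡wm)

  ∈-++-map⁺ : ∀ m → w m ∈ xs ++ map w (allFin n)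
  ∈-++-map⁺ m = ∈-++⁺ʳ xs (∈-map⁺ w (∈-allFin m))

  ∈-++-map-filter<⁻ : ∀ {k : Fin n} {y} → y ∈ xs ++ map w (filter (_<? k) (allFin n)) →
                      y ∈ xs ⊎ ∃[ m ] m Fin.< k × y ≡ w m
  ∈-++-map-filter<⁻ {k} y∈ with ∈-++⁻ xs y∈
  ... | inj₁ y∈xs = inj₁ y∈xs
  ... | inj₂ y∈ws with ∈-map⁻ w y∈ws
  ... | m , m∈ , y≡wm = inj₂ (m , proj₂ (∈-filter⁻ (_<? k) {xs = allFin n} m∈) , y≡wm)

  ∈-++-map-filter<⁺ : ∀ {k m : Fin n} → m Fin.< k → w m ∈ xs ++ map w (filter (_<? k) (allFin n))
  ∈-++-map-filter<⁺ {k} {m} m<k = ∈-++⁺ʳ xs (∈-map⁺ w (∈-filter⁺ (_<? k) (∈-allFin m) m<k))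

  Unique-++-map : Unique xs → (∀ {j k} → w j ≡ w k → j ≡ k) → (∀ m → w m ∉ xs) →
                  ∀ {L} → Unique L → Unique (xs ++ map w L)
  Unique-++-map xs! w-injective w∉xs L! = Unique.++⁺ xs! (Unique.map⁺ w-injective L!) disjoint
    where
    disjoint : ∀ {y} → ¬ (y ∈ xs × y ∈ map w _)
    disjoint (y∈xs , y∈ws) with ∈-map⁻ w y∈ws
    ... | m , _ , refl = w∉xs m y∈xs

module _ {T : Graph} (S : TriSeq T) where

  base : List ℕ
  base = x₀ S ∷ x₁ S ∷ x₂ S ∷ []

  e₁ e₂ : Fin (ℓ S) → ℕ
  e₁ k = proj₁ (e S k)
  e₂ k = proj₂ (e S k)

  excess : Fin (ℓ S) → ℕ
  excess k = deg S k ∸ 2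

  neighbours : Fin (ℓ S) → List ℕ
  neighbours k = filterᵇ (E T (v S k)) (pre S k)

  NoLaterNeighbour : Fin (ℓ S) → Set
  NoLaterNeighbour i = ∀ j → i Fin.< j → ¬ Adj T (v S j) (v S i)

  ∈-pre⁻ : ∀ {k : Fin (ℓ S)} {y} → y ∈ pre S k → y ∈ base ⊎ ∃[ m ] m Fin.< k × y ≡ v S m
  ∈-pre⁻ = ∈-++-map-filter<⁻ base (v S)

  base⊆pre : ∀ {k : Fin (ℓ S)} → base ⊆ pre S k
  base⊆pre = ∈-++⁺ˡ

  v∈pre : ∀ {k m : Fin (ℓ S)} → m Fin.< k → v S m ∈ pre S k
  v∈pre = ∈-++-map-filter<⁺ base (v S)

  base-unique : Unique base
  base-unique = Unique.take⁺ 3 (distinct S)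

  v-injective : ∀ {j k} → v S j ≡ v S k → j ≡ k
  v-injective = Unique-map⇒injective (Unique.drop⁺ 3 (distinct S)) (∈-allFin _) (∈-allFin _)

  v∉base : ∀ m → v S m ∉ base
  v∉base m vm∈base = Unique-++⇒∉ base (distinct S) vm∈base (∈-map⁺ (v S) (∈-allFin m))

  base≢v : ∀ {y} m → y ∈ base → y ≢ v S m
  base≢v m y∈base refl = v∉base m y∈base

  pre-unique : ∀ k → Unique (pre S k)
  pre-unique k = Unique-++-map base (v S) base-unique v-injective v∉base
                   (Unique.filter⁺ (_<? k) (Unique.allFin⁺ _))

  v∈pre⁻ : ∀ {k m : Fin (ℓ S)} → v S m ∈ pre S k → m Fin.< k
  v∈pre⁻ vm∈pre with ∈-pre⁻ vm∈pre
  ... | inj₁ vm∈base             = ⊥-elim (v∉base _ vm∈base)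
  ... | inj₂ (_ , m′<k , vm≡vm′) = subst (Fin._< _) (sym (v-injective vm≡vm′)) m′<k

  pre-split : ∀ {i k : Fin (ℓ S)} {y} → y ∈ pre S k → y ≢ v S i → y ∈ pre S i ⊎ ∃[ m ] i Fin.< m × m Fin.< k × y ≡ v S m
  pre-split {i} y∈pre y≢vi with ∈-pre⁻ y∈pre
  ... | inj₁ y∈base = inj₁ (base⊆pre y∈base)
  ... | inj₂ (m , m<k , y≡vm) with Fin.<-cmp m i
  ... | tri< m<i _ _ = inj₁ (subst (_∈ pre S i) (sym y≡vm) (v∈pre m<i))
  ... | tri≈ _ m≡i _ = ⊥-elim (y≢vi (trans y≡vm (cong (v S) m≡i)))
  ... | tri> _ _ i<m = inj₂ (m , i<m , m<k , y≡vm)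

  V-v : ∀ m → V T (v S m) ≡ true
  V-v m = Equivalence.from (covers S (v S m)) (∈-++-map⁺ base (v S) m)

  neighbours-unique : ∀ k → Unique (neighbours k)
  neighbours-unique k = Unique-filterᵇ (E T (v S k)) (pre-unique k)

  ∈-neighbours⁺ : ∀ {k : Fin (ℓ S)} {y} → y ∈ pre S k → Adj T (v S k) y → y ∈ neighbours k
  ∈-neighbours⁺ {k} = ∈-filterᵇ⁺ {p = E T (v S k)}

  ∈-neighbours⁻ : ∀ {k : Fin (ℓ S)} {y} → y ∈ neighbours k → y ∈ pre S k × Adj T (v S k) y
  ∈-neighbours⁻ {k} = ∈-filterᵇ⁻ {p = E T (v S k)} (pre S k)

  e₁≢e₂ : ∀ k → e₁ k ≢ e₂ k
  e₁≢e₂ k = Adj⇒≢ {T} (e-edge S k)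

  e₁∈neighbours : ∀ k → e₁ k ∈ neighbours k
  e₁∈neighbours k = ∈-neighbours⁺ (proj₁ (e-pre S k)) (proj₁ (v-tri S k))

  e₂∈neighbours : ∀ k → e₂ k ∈ neighbours k
  e₂∈neighbours k = ∈-neighbours⁺ (proj₂ (e-pre S k)) (proj₂ (v-tri S k))

  2≤deg : ∀ k → 2 ≤ deg S k
  2≤deg k = Unique-⊆⇒length≤ ((e₁≢e₂ k ∷ []) ∷ [] ∷ []) λ where
    (here refl)         → e₁∈neighbours k
    (there (here refl)) → e₂∈neighbours k

  regular-neighbour : ∀ {k : Fin (ℓ S)} {y} → regular S k → y ∈ pre S k → Adj T (v S k) y → y ≡ e₁ k ⊎ y ≡ e₂ k
  regular-neighbour {k} deg≡2 y∈pre vk~y =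
    length≡2⇒≡⊎≡ deg≡2 (e₁∈neighbours k) (e₂∈neighbours k) (e₁≢e₂ k) (∈-neighbours⁺ y∈pre vk~y)

  regular-triangle : ∀ {k : Fin (ℓ S)} {y} → regular S k → y ∈ pre S k → Adj T (v S k) y →
                     ∃[ c ] c ∈ pre S k × Adj T (v S k) c × Adj T y c × c ≢ y
  regular-triangle {k} reg y∈pre vk~y with regular-neighbour reg y∈pre vk~y
  ... | inj₁ refl = e₂ k , proj₂ (e-pre S k) , proj₂ (v-tri S k) , e-edge S k , e₁≢e₂ k ∘ sym
  ... | inj₂ refl = e₁ k , proj₁ (e-pre S k) , proj₁ (v-tri S k) , Adj-sym {T} (e-edge S k) , e₁≢e₂ k

  tri-kept : ∀ {G} → (∀ {y z} → y ∈ base → z ∈ base → Adj T y z → Adj G y z) →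
             Adj G (x₀ S) (x₁ S) × Adj G (x₁ S) (x₂ S) × Adj G (x₀ S) (x₂ S)
  tri-kept keep = keep x₀∈ x₁∈ (proj₁ (tri S))
                , keep x₁∈ x₂∈ (proj₁ (proj₂ (tri S)))
                , keep x₀∈ x₂∈ (proj₂ (proj₂ (tri S)))
    where
    x₀∈ : x₀ S ∈ base
    x₀∈ = here refl
    x₁∈ : x₁ S ∈ base
    x₁∈ = there (here refl)
    x₂∈ : x₂ S ∈ base
    x₂∈ = there (there (here refl))

  0<r⇒Fin : 0 < r S → Fin (ℓ S)
  0<r⇒Fin 0<r = 0<∑⇒Fin excess (subst (0 <_) (sum-map-allFin excess) 0<r)

  earlierNeighbour≢ : ∀ {i k : Fin (ℓ S)} {y} → NoLaterNeighbour i → y ∈ pre S k → Adj T (v S k) y → y ≢ v S i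
  earlierNeighbour≢ lonely y∈pre vk~y refl = lonely _ (v∈pre⁻ y∈pre) vk~y

module VertexDeletion {T : Graph} (S : TriSeq T) (i : Fin (ℓ S)) (lonely : NoLaterNeighbour S i) where

  T′ : Graph
  T′ = deleteVertex T (v S i)

  ℓ′ : ℕ
  ℓ′ = pred (ℓ S)

  p : Fin ℓ′ → Fin (ℓ S)
  p = punchIn′ i

  v′ : Fin ℓ′ → ℕ
  v′ = v S ∘ p

  v′-injective : ∀ {j k} → v′ j ≡ v′ k → j ≡ k
  v′-injective = punchIn′-injective i ∘ v-injective S

  v′≢vᵢ : ∀ j → v′ j ≢ v S i
  v′≢vᵢ j = punchIn′ᵢ≢i i j ∘ v-injective S

  base≢vᵢ : ∀ {y} → y ∈ base S → y ≢ v S i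
  base≢vᵢ = base≢v S i

  neighbour≢vᵢ : ∀ {k y} → y ∈ pre S k → Adj T (v S k) y → y ≢ v S i
  neighbour≢vᵢ = earlierNeighbour≢ S lonely

  e₁≢vᵢ : ∀ j → e₁ S (p j) ≢ v S i
  e₁≢vᵢ j = neighbour≢vᵢ (proj₁ (e-pre S (p j))) (proj₁ (v-tri S (p j)))

  e₂≢vᵢ : ∀ j → e₂ S (p j) ≢ v S i
  e₂≢vᵢ j = neighbour≢vᵢ (proj₂ (e-pre S (p j))) (proj₂ (v-tri S (p j)))

  pre′ : Fin ℓ′ → List ℕ
  pre′ j = base S ++ map v′ (filter (_<? j) (allFin ℓ′))

  pre′⁺ : ∀ {j y} → y ∈ pre S (p j) → y ≢ v S i → y ∈ pre′ j
  pre′⁺ y∈pre y≢vᵢ with ∈-pre⁻ S y∈pre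
  ... | inj₁ y∈base = ∈-++⁺ˡ y∈base
  ... | inj₂ (m , m<pj , refl) with punchIn′-surjective i (y≢vᵢ ∘ cong (v S))
  ... | m′ , refl = ∈-++-map-filter<⁺ (base S) v′ (punchIn′-cancel-< i m<pj)

  pre′⁻ : ∀ {j y} → y ∈ pre′ j → y ∈ pre S (p j)
  pre′⁻ y∈pre′ with ∈-++-map-filter<⁻ (base S) v′ y∈pre′
  ... | inj₁ y∈base        = base⊆pre S y∈base
  ... | inj₂ (m , m<j , refl) = v∈pre S (punchIn′-mono-< i m<j)

  allV′ : List ℕ
  allV′ = base S ++ map v′ (allFin ℓ′)

  covers′ : ∀ x → (V T′ x ≡ true) ⇔ (x ∈ allV′)
  covers′ x = mk⇔ to from
    where
    to : V T′ x ≡ true → x ∈ allV′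
    to V′x with deleteVertex-V⁻ {T} V′x
    ... | Vx , x≢vᵢ with ∈-++-map⁻ (base S) (v S) (Equivalence.to (covers S x) Vx)
    ... | inj₁ x∈base = ∈-++⁺ˡ x∈base
    ... | inj₂ (m , refl) with punchIn′-surjective i (x≢vᵢ ∘ cong (v S))
    ... | m′ , refl = ∈-++-map⁺ (base S) v′ m′
    from : x ∈ allV′ → V T′ x ≡ true
    from x∈allV′ with ∈-++-map⁻ (base S) v′ x∈allV′
    ... | inj₁ x∈base = deleteVertex-V⁺ {T} (Equivalence.from (covers S x) (∈-++⁺ˡ x∈base)) (base≢vᵢ x∈base)
    ... | inj₂ (m , refl) = deleteVertex-V⁺ {T} (V-v S (p m)) (v′≢vᵢ m)

  S′ : TriSeq T′
  S′ = record
    { ℓ        = ℓ′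
    ; x₀       = x₀ S
    ; x₁       = x₁ S
    ; x₂       = x₂ S
    ; v        = v′
    ; e        = e S ∘ p
    ; distinct = Unique-++-map (base S) v′ (base-unique S) v′-injective (v∉base S ∘ p) (Unique.allFin⁺ ℓ′)
    ; covers   = covers′
    ; tri      = tri-kept S {T′} (λ y∈base z∈base y~z → keep y~z (base≢vᵢ y∈base) (base≢vᵢ z∈base))
    ; e-pre    = λ j → pre′⁺ (proj₁ (e-pre S (p j))) (e₁≢vᵢ j) , pre′⁺ (proj₂ (e-pre S (p j))) (e₂≢vᵢ j)
    ; e-edge   = λ j → keep (e-edge S (p j)) (e₁≢vᵢ j) (e₂≢vᵢ j)
    ; v-tri    = λ j → keep (proj₁ (v-tri S (p j))) (v′≢vᵢ j) (e₁≢vᵢ j)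
                     , keep (proj₂ (v-tri S (p j))) (v′≢vᵢ j) (e₂≢vᵢ j)
    }
    where
    keep : ∀ {y z} → Adj T y z → y ≢ v S i → z ≢ v S i → Adj T′ y z
    keep = deleteVertex-Adj⁺ {T}

  deg′≡deg : ∀ j → deg S′ j ≡ deg S (p j)
  deg′≡deg j = ≤-antisym (Unique-⊆⇒length≤ (neighbours-unique S′ j) neighbours′⊆)
                         (Unique-⊆⇒length≤ (neighbours-unique S (p j)) ⊆neighbours′)
    where
    neighbours′⊆ : neighbours S′ j ⊆ neighbours S (p j)
    neighbours′⊆ y∈ with ∈-neighbours⁻ S′ y∈
    ... | y∈pre′ , vj~y = ∈-neighbours⁺ S (pre′⁻ y∈pre′) (deleteVertex-Adj⁻ {T} vj~y)
    ⊆neighbours′ : neighbours S (p j) ⊆ neighbours S′ j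
    ⊆neighbours′ {y} y∈ with ∈-neighbours⁻ S y∈
    ... | y∈pre , vj~y = ∈-neighbours⁺ S′ (pre′⁺ y∈pre y≢vᵢ) (deleteVertex-Adj⁺ {T} vj~y (v′≢vᵢ j) y≢vᵢ)
      where
      y≢vᵢ : y ≢ v S i
      y≢vᵢ = neighbour≢vᵢ y∈pre vj~y

  r-split : r S ≡ excess S i + r S′
  r-split = begin
    r S                            ≡⟨ sum-map-allFin (excess S) ⟩
    ∑ (excess S)                   ≡⟨ ∑-punchIn′ (excess S) i ⟩
    excess S i + ∑ (excess S ∘ p)  ≡⟨ cong (excess S i +_) (sum-cong-≗ (cong (_∸ 2) ∘ sym ∘ deg′≡deg)) ⟩
    excess S i + ∑ (excess S′)     ≡⟨ cong (excess S i +_) (sum-map-allFin (excess S′)) ⟨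
    excess S i + r S′              ∎
    where open ≡-Reasoning

  T′⊂T : T′ ⊂G T
  T′⊂T = deleteVertex-⊂ {T} (V-v S i)

module EdgeDeletion {T : Graph} (S : TriSeq T) (k : Fin (ℓ S)) (lonely : NoLaterNeighbour S k)
                    {u : ℕ} (vₖ~u : Adj T (v S k) u)
                    (u≢e₁ : u ≢ e₁ S k) (u≢e₂ : u ≢ e₂ S k) where

  T′ : Graph
  T′ = deleteEdge T (v S k) u

  neighbour≢vₖ : ∀ {j y} → y ∈ pre S j → Adj T (v S j) y → y ≢ v S k
  neighbour≢vₖ = earlierNeighbour≢ S lonely

  keep-away : ∀ {y z} → Adj T y z → y ≢ v S k → z ≢ v S k → Adj T′ y z
  keep-away y~z y≢vₖ z≢vₖ = deleteEdge-Adj⁺ {T} y~z (λ y≡vₖ → ⊥-elim (y≢vₖ y≡vₖ)) (λ _ → z≢vₖ)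

  keep-neighbour : ∀ {j y} → y ∈ pre S j → Adj T (v S j) y → (v S j ≡ v S k → y ≢ u) → Adj T′ (v S j) y
  keep-neighbour y∈pre vj~y ≢u = deleteEdge-Adj⁺ {T} vj~y ≢u (λ _ → neighbour≢vₖ y∈pre vj~y)

  e₁≢u : ∀ j → v S j ≡ v S k → e₁ S j ≢ u
  e₁≢u j vj≡vₖ with v-injective S vj≡vₖ
  ... | refl = u≢e₁ ∘ sym

  e₂≢u : ∀ j → v S j ≡ v S k → e₂ S j ≢ u
  e₂≢u j vj≡vₖ with v-injective S vj≡vₖ
  ... | refl = u≢e₂ ∘ sym

  S′ : TriSeq T′
  S′ = record
    { ℓ        = ℓ S
    ; x₀       = x₀ S
    ; x₁       = x₁ S
    ; x₂       = x₂ S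
    ; v        = v S
    ; e        = e S
    ; distinct = distinct S
    ; covers   = covers S
    ; tri      = tri-kept S {T′} (λ y∈base z∈base y~z → keep-away y~z (base≢v S k y∈base) (base≢v S k z∈base))
    ; e-pre    = e-pre S
    ; e-edge   = λ j → keep-away (e-edge S j) (neighbour≢vₖ (proj₁ (e-pre S j)) (proj₁ (v-tri S j)))
                                             (neighbour≢vₖ (proj₂ (e-pre S j)) (proj₂ (v-tri S j)))
    ; v-tri    = λ j → keep-neighbour (proj₁ (e-pre S j)) (proj₁ (v-tri S j)) (e₁≢u j)
                     , keep-neighbour (proj₂ (e-pre S j)) (proj₂ (v-tri S j)) (e₂≢u j)
    }

  deg≤deg′ : ∀ j → j ≢ k → deg S j ≤ deg S′ j
  deg≤deg′ j j≢k = Unique-⊆⇒length≤ (neighbours-unique S j) ⊆neighbours′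
    where
    ⊆neighbours′ : neighbours S j ⊆ neighbours S′ j
    ⊆neighbours′ y∈ with ∈-neighbours⁻ S y∈
    ... | y∈pre , vj~y = ∈-neighbours⁺ S′ y∈pre
                           (keep-neighbour y∈pre vj~y (λ vj≡vₖ → ⊥-elim (j≢k (v-injective S vj≡vₖ))))

  degₖ≤1+deg′ₖ : deg S k ≤ suc (deg S′ k)
  degₖ≤1+deg′ₖ = Unique-⊆⇒length≤ (neighbours-unique S k) ⊆u∷neighbours′
    where
    ⊆u∷neighbours′ : neighbours S k ⊆ u ∷ neighbours S′ k
    ⊆u∷neighbours′ {y} y∈ with y ≟ u | ∈-neighbours⁻ S y∈
    ... | yes y≡u | _             = here y≡u
    ... | no  y≢u | y∈pre , vₖ~y = there (∈-neighbours⁺ S′ y∈pre (keep-neighbour y∈pre vₖ~y (λ _ → y≢u)))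

  r≤1+r′ : r S ≤ suc (r S′)
  r≤1+r′ = begin
    r S                                             ≡⟨ sum-map-allFin (excess S) ⟩
    ∑ (excess S)                                    ≡⟨ ∑-punchIn′ (excess S) k ⟩
    excess S k + ∑ (excess S ∘ punchIn′ k)          ≤⟨ +-mono-≤ excessₖ≤ (∑-mono-≤ excess≤) ⟩
    suc (excess S′ k) + ∑ (excess S′ ∘ punchIn′ k)  ≡⟨ cong suc (∑-punchIn′ (excess S′) k) ⟨
    suc (∑ (excess S′))                             ≡⟨ cong suc (sum-map-allFin (excess S′)) ⟨
    suc (r S′)                                      ∎
    where
    open ≤-Reasoning
    excessₖ≤ : excess S k ≤ suc (excess S′ k)
    excessₖ≤ = ≤-trans (∸-monoˡ-≤ 2 degₖ≤1+deg′ₖ) (suc[m]∸n≤suc[m∸n] (deg S′ k) 2)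
    excess≤ : ∀ j → excess S (punchIn′ k j) ≤ excess S′ (punchIn′ k j)
    excess≤ j = ∸-monoˡ-≤ 2 (deg≤deg′ _ (punchIn′ᵢ≢i k j))

  T′⊂T : T′ ⊂G T
  T′⊂T = deleteEdge-⊂ {T} vₖ~u

module MinimalSequence {T : Graph} (S : TriSeq T) {ρ : ℕ} (minimal : Minimal ρ S) where

  ρ≤r : ρ ≤ r S
  ρ≤r = proj₁ minimal

  proper⇒r<ρ : ∀ {T′} (S′ : TriSeq T′) → T′ ⊂G T → r S′ < ρ
  proper⇒r<ρ S′ T′⊂T = ≰⇒> (λ ρ≤r′ → proj₂ minimal _ S′ ρ≤r′ T′⊂T)

  noLaterNeighbour⇒r<excess+ρ : ∀ {i} → NoLaterNeighbour S i → r S < excess S i + ρ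
  noLaterNeighbour⇒r<excess+ρ {i} lonely = begin-strict
    r S                ≡⟨ r-split ⟩
    excess S i + r S′  <⟨ +-monoʳ-< (excess S i) (proper⇒r<ρ S′ T′⊂T) ⟩
    excess S i + ρ     ∎
    where
    open VertexDeletion S i lonely
    open ≤-Reasoning

  noLaterNeighbour⇒r≤ρ : ∀ {k} → NoLaterNeighbour S k → r S ≤ ρ
  noLaterNeighbour⇒r≤ρ {k} lonely with 3 ≤? deg S k
  ... | no 3≰deg = <⇒≤ (subst (λ x → r S < x + ρ) excess≡0 (noLaterNeighbour⇒r<excess+ρ lonely))
    where
    excess≡0 : excess S k ≡ 0
    excess≡0 = m≤n⇒m∸n≡0 (s≤s⁻¹ (≰⇒> 3≰deg))
  ... | yes 3≤deg with Unique-length>⇒∃∉ _≟_ {ys = e₁ S k ∷ e₂ S k ∷ []} (neighbours-unique S k) 3≤deg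
  ... | u , u∈neighbours , u∉e = ≤-trans r≤1+r′ (proper⇒r<ρ S′ T′⊂T)
    where
    open EdgeDeletion S k lonely (proj₂ (∈-neighbours⁻ S u∈neighbours)) (u∉e ∘ here) (u∉e ∘ there ∘ here)

  r≤ρ : r S ≤ ρ
  r≤ρ with r S ≤? ρ
  ... | yes r≤ρ = r≤ρ
  ... | no  r≰ρ with lastIndex (0<r⇒Fin S (≤-<-trans z≤n (≰⇒> r≰ρ)))
  ... | last , last-greatest = noLaterNeighbour⇒r≤ρ {last} λ j last<j _ → last-greatest j last<j

  r≡ρ : r S ≡ ρ
  r≡ρ = ≤-antisym r≤ρ ρ≤r

  irregularCount≤ρ : irregularCount S ≤ ρ
  irregularCount≤ρ = subst (irregularCount S ≤_) r≡ρ (length-filter≢2≤sum∸2 (deg S) (2≤deg S) (allFin _))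

  deg≤ρ+2 : ∀ k → deg S k ≤ ρ + 2
  deg≤ρ+2 k = begin
    deg S k         ≤⟨ m≤n+m∸n (deg S k) 2 ⟩
    2 + excess S k  ≤⟨ +-monoʳ-≤ 2 excess≤ρ ⟩
    2 + ρ           ≡⟨ +-comm 2 ρ ⟩
    ρ + 2           ∎
    where
    open ≤-Reasoning
    excess≤ρ : excess S k ≤ ρ
    excess≤ρ = subst (excess S k ≤_) (trans (sym (sum-map-allFin (excess S))) r≡ρ) (≤∑ (excess S) k)

  earlierNeighbour? : ∀ k i → Dec (i Fin.< k × Adj T (v S k) (v S i))
  earlierNeighbour? k i = i <? k ×-dec (E T (v S k) (v S i) Bool.≟ true)

  earlierNeighbours : Fin (ℓ S) → List (Fin (ℓ S))
  earlierNeighbours k = filter (earlierNeighbour? k) (allFin _)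

  length-earlierNeighbours≤deg : ∀ k → length (earlierNeighbours k) ≤ deg S k
  length-earlierNeighbours≤deg k = begin
    length (earlierNeighbours k)            ≡⟨ length-map (v S) (earlierNeighbours k) ⟨
    length (map (v S) (earlierNeighbours k)) ≤⟨ Unique-⊆⇒length≤ unique ⊆neighbours ⟩
    deg S k                                 ∎
    where
    open ≤-Reasoning
    unique : Unique (map (v S) (earlierNeighbours k))
    unique = Unique.map⁺ (v-injective S) (Unique.filter⁺ _ (Unique.allFin⁺ _))
    ⊆neighbours : map (v S) (earlierNeighbours k) ⊆ neighbours S k
    ⊆neighbours y∈ with ∈-map⁻ (v S) y∈
    ... | i , i∈ , refl with ∈-filter⁻ (earlierNeighbour? k) {xs = allFin _} i∈
    ... | _ , i<k , vₖ~vᵢ = ∈-neighbours⁺ S (v∈pre S i<k) vₖ~vᵢ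

  irregularSteps : List (Fin (ℓ S))
  irregularSteps = filterᵇ (λ i → not (deg S i ≡ᵇ 2)) (allFin _)

  exceptions : List (Fin (ℓ S))
  exceptions = concatMap earlierNeighbours irregularSteps

  length-exceptions : length exceptions ≤ ρ * (ρ + 2)
  length-exceptions = ≤-trans
    (length-concatMap≤ earlierNeighbours (λ k → ≤-trans (length-earlierNeighbours≤deg k) (deg≤ρ+2 k)) irregularSteps)
    (*-monoˡ-≤ (ρ + 2) irregularCount≤ρ)

  ∈-exceptions : ∀ {i k} → ¬ regular S k → i Fin.< k → Adj T (v S k) (v S i) → i ∈ exceptions
  ∈-exceptions {i} {k} irregular i<k vₖ~vᵢ =
    ∈-concat⁺′ (∈-filter⁺ (earlierNeighbour? k) (∈-allFin i) (i<k , vₖ~vᵢ))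
               (∈-map⁺ earlierNeighbours (∈-filterᵇ⁺ (∈-allFin k) (≢⇒not≡ᵇ irregular)))

  module _ {i} (regularᵢ : regular S i) (i∉exceptions : i ∉ exceptions) where

    laterNeighbour-regular : ∀ {k} → i Fin.< k → Adj T (v S k) (v S i) → regular S k
    laterNeighbour-regular {k} i<k vₖ~vᵢ with deg S k ≟ 2
    ... | yes regularₖ  = regularₖ
    ... | no  irregular = ⊥-elim (i∉exceptions (∈-exceptions irregular i<k vₖ~vᵢ))

    descend : ∀ k → Acc Fin._<_ k → i Fin.< k → Adj T (v S k) (v S i) → GoodStep S i
    descend k (acc smaller) i<k vₖ~vᵢ
      with regular-triangle S (laterNeighbour-regular i<k vₖ~vᵢ) (v∈pre S i<k) vₖ~vᵢ
    ... | c , c∈pre , vₖ~c , vᵢ~c , c≢vᵢ with pre-split S c∈pre c≢vᵢ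
    ... | inj₁ c∈preᵢ = c , regular-neighbour S regularᵢ c∈preᵢ vᵢ~c , vᵢ~c , k , i<k , vₖ~vᵢ , vₖ~c
    ... | inj₂ (m , i<m , m<k , refl) = descend m (smaller m<k) i<m (Adj-sym {T} vᵢ~c)

    goodStep : GoodStep S i
    goodStep with any? (λ k → earlierNeighbour? k i) (allFin _)
    ... | yes later with find later
    ... | k , _ , i<k , vₖ~vᵢ = descend k (<-wellFounded k) i<k vₖ~vᵢ
    goodStep | no none = ⊥-elim (<⇒≱ r<ρ ρ≤r)
      where
      lonely : NoLaterNeighbour S i
      lonely j i<j vⱼ~vᵢ = none (lose (∈-allFin j) (i<j , vⱼ~vᵢ))
      r<ρ : r S < ρ
      r<ρ = subst (λ d → r S < d ∸ 2 + ρ) regularᵢ (noLaterNeighbour⇒r<excess+ρ lonely)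

proposition3p5 : (ρ : ℕ) → ρ ≥ 1 → {T : Graph} (S : TriSeq T) → Minimal ρ S →
    (r S ≡ ρ) × (irregularCount S ≤ ρ) ×
    Σ (List (Fin (ℓ S))) (λ B → (length B ≤ ρ * (ρ + 2)) ×
      (∀ i → regular S i → i ∉ B → GoodStep S i))
proposition3p5 ρ _ S minimal =
  r≡ρ , irregularCount≤ρ , exceptions , length-exceptions , λ _ → goodStep
  where open MinimalSequence S minimal
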